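{- Let $\gamma=((i_1\,j_1),\ldots,(i_k\,j_k))\in\Sigma_n(k)$ and $l\in\{1,\ldots,k-1\}$. Then $P(\sigma_l\cdot\gamma)=\sigma_l\cdot P(\gamma)$. Moreover, writing $\sigma_l\cdot\gamma=((i_{\sigma_l^{ -1}(1)}\,\tilde j_1),\ldots,(i_{\sigma_l^{ -1}(k)}\,\tilde j_k))$, the sets $\bigcup_{s=1}^k\{i_s,j_s\}$ and $\bigcup_{s=1}^k\{i_s,\tilde j_s\}$ are equal.
   Context: Permutations are multiplied with the right factor applied first. $\mathsf T_n$ is the set of transpositions of $\{1,\ldots,n\}$; a transposition is written $(i\,j)$ with $i<j$. For $\sigma\in\mathfrak S_n$, $|\sigma|=n-(\text{number of cycles of }\sigma\text{, fixed points included})$, and $\sigma_1\preccurlyeq\sigma_2$ iff $|\sigma_2|=|\sigma_1|+|\sigma_1^{ -1}\sigma_2|$. $\Sigma_n(k)=\{(\tau_1,\ldots,\tau_k)\in(\mathsf T_n)^k : |\tau_1\cdots\tau_k|=k,\ \tau_1\cdots\tau_k\preccurlyeq(1\,2\,\cdots\,n)\}$. $P:\Sigma_n(k)\to\{1,\ldots,n-1\}^k$ sends $((i_1\,j_1),\ldots,(i_k\,j_k))$ to $(i_1,\ldots,i_k)$. $\sigma_l=(l\;l+1)\in\mathfrak S_k$ acts on sequences by $\sigma_l\cdot(x_1,\ldots,x_k)=(x_{\sigma_l^{ -1}(1)},\ldots,x_{\sigma_l^{ -1}(k)})$, and on $\gamma=(g_1,\ldots,g_k)=((i_1\,j_1),\ldots,(i_k\,j_k))\in\Sigma_n(k)$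 by: $\sigma_l\cdot\gamma=\gamma$ if $i_l=i_{l+1}$; if $i_l<i_{l+1}$, the consecutive pair $(g_l,g_{l+1})$ is replaced by $(g_{l+1},\,g_{l+1}g_lg_{l+1})$; if $i_l>i_{l+1}$, it is replaced by $(g_lg_{l+1}g_l,\,g_l)$; all other entries unchanged. (The result lies in $\Sigma_n(k)$.) -}

module Defs where

open import Data.Nat as ℕ using (ℕ; zero; suc; _∸_; _+_)
open import Data.Nat.Properties using (<-trans; n<1+n)
open import Data.Fin as F using (Fin; toℕ; fromℕ<)
open import Data.Fin.Properties using (_≟_; _≤?_)
open import Data.List using (List; []; _∷_; length; filter; upTo; allFin; foldr; map)
open import Data.List.Relation.Unary.All using (all?)
open import Data.Product using (Σ; _×_; _,_; ∃)
open import Data.Sum using (_⊎_)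
open import Relation.Nullary using (yes; no; ¬_)
open import Relation.Binary.PropositionalEquality using (_≡_)

-- Points {1,…,n} are represented (0-indexed) by Fin n, with the usual
-- order.  A permutation is represented by its underlying function
-- Fin n → Fin n; products are function composition (right factor first).

Perm : ℕ → Set
Perm n = Fin n → Fin n

infixr 9 _∙_
_∙_ : ∀ {n} → Perm n → Perm n → Perm n
(σ ∙ τ) x = σ (τ x)

idP : ∀ {n} → Perm n
idP x = x

_≐_ : ∀ {n} → Perm n → Perm n → Set
σ ≐ τ = ∀ x → σ x ≡ τ x

swap : ∀ {n} → Fin n → Fin n → Perm n
swap a b x with x ≟ a
... | yes _ = b
... | no _ with x ≟ b
...   | yes _ = a
...   | no _ = x

findPre : ∀ {n} → Perm n → Fin n → List (Fin n) → Fin n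
findPre σ y [] = y
findPre σ y (x ∷ xs) with σ x ≟ y
... | yes _ = x
... | no _ = findPre σ y xs

inv : ∀ {n} → Perm n → Perm n
inv {n} σ y = findPre σ y (allFin n)

iter : ∀ {n} → Perm n → ℕ → Perm n
iter σ zero x = x
iter σ (suc m) x = σ (iter σ m x)

-- number of cycles of σ (fixed points included): each cycle is counted
-- once, via its least element x, i.e. x ≤ σ^m x for all m < n
-- (the orbit of x under a permutation of Fin n is {σ^m x | m < n}).
cycles : ∀ {n} → Perm n → ℕ
cycles {n} σ =
  length (filter (λ x → all? (λ m → x ≤? iter σ m x) (upTo n)) (allFin n))

∣_∣ₚ : ∀ {n} → Perm n → ℕ
∣_∣ₚ {n} σ = n ∸ cycles σ

_≼_ : ∀ {n} → Perm n → Perm n → Set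
σ₁ ≼ σ₂ = ∣ σ₂ ∣ₚ ≡ ∣ σ₁ ∣ₚ + ∣ inv σ₁ ∙ σ₂ ∣ₚ

longCycle : ∀ n → Perm n
longCycle (suc m) x with toℕ x ℕ.<? m
... | yes p = F.suc (fromℕ< p)
... | no _ = F.zero

record Transp (n : ℕ) : Set where
  constructor tr
  field
    i j : Fin n
    i<j : i F.< j
open Transp public

perm : ∀ {n} → Transp n → Perm n
perm t = swap (i t) (j t)

_≈ₜ_ : ∀ {n} → Transp n → Transp n → Set
s ≈ₜ t = (i s ≡ i t) × (j s ≡ j t)

-- sequences of k transpositions, positions 0-indexed by Fin k
Seq : ℕ → ℕ → Set
Seq n k = Fin k → Transp n

prodList : ∀ {n} → List (Transp n) → Perm n
prodList = foldr (λ t σ → perm t ∙ σ) idP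

prod : ∀ {n k} → Seq n k → Perm n
prod {k = k} γ = prodList (map γ (allFin k))

InΣ : ∀ n k → Seq n k → Set
InΣ n k γ = (∣ prod γ ∣ₚ ≡ k) × (prod γ ≼ longCycle n)

P : ∀ {n k} → Seq n k → Fin k → Fin n
P γ s = i (γ s)

-- The generator σ_l (1 ≤ l ≤ k−1).  In 0-indexed positions, σ_l swaps
-- positions a = l−1 and b = l, where l : ℕ with 1 + l < k represents
-- the paper's l − 1.

posA : ∀ {k} (l : ℕ) → suc l ℕ.< k → Fin k
posA l h = fromℕ< (<-trans (n<1+n l) h)

posB : ∀ {k} (l : ℕ) → suc l ℕ.< k → Fin k
posB l h = fromℕ< h

-- σ_l · (x₁,…,x_k) = (x_{σ_l⁻¹(1)},…,x_{σ_l⁻¹(k)}); σ_l⁻¹ = σ_l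
actSeq : ∀ {A : Set} {k} (l : ℕ) (h : suc l ℕ.< k) → (Fin k → A) → (Fin k → A)
actSeq l h x p = x (swap (posA l h) (posB l h) p)

-- ActΣ l h γ γ' : γ' = σ_l · γ  (entries outside {a,b} unchanged; at
-- positions a,b the rule of the paper, with products of permutations
-- compared extensionally)
record ActΣ {n k} (l : ℕ) (h : suc l ℕ.< k) (γ γ' : Seq n k) : Set where
  a = posA l h
  b = posB l h
  field
    others : ∀ p → ¬ (p ≡ a) → ¬ (p ≡ b) → γ' p ≈ₜ γ p
    caseEq : i (γ a) ≡ i (γ b) → (γ' a ≈ₜ γ a) × (γ' b ≈ₜ γ b)
    caseLt : i (γ a) F.< i (γ b) →
               (γ' a ≈ₜ γ b) ×
               (perm (γ' b) ≐ (perm (γ b) ∙ perm (γ a) ∙ perm (γ b)))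
    caseGt : i (γ b) F.< i (γ a) →
               (perm (γ' a) ≐ (perm (γ a) ∙ perm (γ b) ∙ perm (γ a))) ×
               (γ' b ≈ₜ γ a)

Support : ∀ {n k} → Seq n k → Fin n → Set
Support {k = k} γ x = Σ (Fin k) λ s → (x ≡ i (γ s)) ⊎ (x ≡ j (γ s))

module Submission where

-- The move only touches the pair (g_l, g_{l+1}), so the proof is local;
-- in particular it holds for every sequence of transpositions.

open import Defs
open import Data.Nat using (ℕ; suc; _<_)
import Data.Nat.Properties as ℕ
open import Data.Fin using (Fin; toℕ)
import Data.Fin as F
open import Data.Fin.Properties using (_≟_; <-cmp; <-irrefl; <-trans; <⇒≢; toℕ-fromℕ<)
open import Data.Vec.Functional using (updateAt)
open import Data.Vec.Functional.Properties using (updateAt-updates; updateAt-minimal)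
open import Data.Product using (Σ; _×_; _,_; proj₁; proj₂)
open import Data.Sum using (_⊎_; inj₁; inj₂) renaming (swap to ⊎-swap)
open import Data.Empty using (⊥-elim)
open import Function using (const)
open import Function.Bundles using (_⇔_; mk⇔; Equivalence)
open import Relation.Nullary using (yes; no)
open import Relation.Binary using (tri<; tri≈; tri>)
open import Relation.Binary.PropositionalEquality
  using (_≡_; _≢_; refl; sym; trans; cong; subst₂)

open Equivalence using (to; from)

data SwapView {n} (a b x : Fin n) : Fin n → Set where
  at-a      : x ≡ a → SwapView a b x b
  at-b      : x ≡ b → SwapView a b x a
  elsewhere : x ≢ a → x ≢ b → SwapView a b x x

swap-view : ∀ {n} (a b x : Fin n) → SwapView a b x (swap a b x)
swap-view a b x with x ≟ a
... | yes x≡a = at-a x≡a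
... | no x≢a with x ≟ b
...   | yes x≡b = at-b x≡b
...   | no x≢b = elsewhere x≢a x≢b

swap-at-a : ∀ {n} (a b : Fin n) → swap a b a ≡ b
swap-at-a a b with swap a b a | swap-view a b a
... | _ | at-a _ = refl
... | _ | at-b a≡b = a≡b
... | _ | elsewhere a≢a _ = ⊥-elim (a≢a refl)

swap-at-b : ∀ {n} (a b : Fin n) → swap a b b ≡ a
swap-at-b a b with swap a b b | swap-view a b b
... | _ | at-a b≡a = b≡a
... | _ | at-b _ = refl
... | _ | elsewhere _ b≢b = ⊥-elim (b≢b refl)

swap-elsewhere : ∀ {n} (a b x : Fin n) → x ≢ a → x ≢ b → swap a b x ≡ x
swap-elsewhere a b x x≢a x≢b with swap a b x | swap-view a b x
... | _ | at-a x≡a = ⊥-elim (x≢a x≡a)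
... | _ | at-b x≡b = ⊥-elim (x≢b x≡b)
... | _ | elsewhere _ _ = refl

swap-involutive : ∀ {n} (a b x : Fin n) → swap a b (swap a b x) ≡ x
swap-involutive a b x with swap a b x | swap-view a b x
... | _ | at-a refl = swap-at-b x b
... | _ | at-b refl = swap-at-a a x
... | _ | elsewhere x≢a x≢b = swap-elsewhere a b x x≢a x≢b

swap-moved : ∀ {n} (a b x : Fin n) → swap a b x ≢ x → x ≡ a ⊎ x ≡ b
swap-moved a b x moved with swap a b x | swap-view a b x
... | _ | at-a x≡a = inj₁ x≡a
... | _ | at-b x≡b = inj₂ x≡b
... | _ | elsewhere _ _ = ⊥-elim (moved refl)

conj-swap : ∀ {n} (σ σ⁻¹ : Perm n) →
            (∀ x → σ (σ⁻¹ x) ≡ x) → (∀ x → σ⁻¹ (σ x) ≡ x) →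
            ∀ a b → (σ ∙ swap a b ∙ σ⁻¹) ≐ swap (σ a) (σ b)
conj-swap σ σ⁻¹ right left a b x with swap a b (σ⁻¹ x) | swap-view a b (σ⁻¹ x)
... | _ | at-a e =
  sym (trans (cong (swap (σ a) (σ b)) (trans (sym (right x)) (cong σ e)))
             (swap-at-a (σ a) (σ b)))
... | _ | at-b e =
  sym (trans (cong (swap (σ a) (σ b)) (trans (sym (right x)) (cong σ e)))
             (swap-at-b (σ a) (σ b)))
... | _ | elsewhere ≢a ≢b =
  trans (right x) (sym (swap-elsewhere (σ a) (σ b) x
    (λ e → ≢a (trans (cong σ⁻¹ e) (left a)))
    (λ e → ≢b (trans (cong σ⁻¹ e) (left b)))))

_∈ₜ_ : ∀ {n} → Fin n → Transp n → Set
x ∈ₜ t = (x ≡ i t) ⊎ (x ≡ j t)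

≈ₜ-sym : ∀ {n} (s t : Transp n) → s ≈ₜ t → t ≈ₜ s
≈ₜ-sym _ _ (i≡ , j≡) = sym i≡ , sym j≡

∈ₜ-resp-≈ : ∀ {n} {x : Fin n} (s t : Transp n) → s ≈ₜ t → x ∈ₜ s → x ∈ₜ t
∈ₜ-resp-≈ _ _ (i≡ , _) (inj₁ e) = inj₁ (trans e i≡)
∈ₜ-resp-≈ _ _ (_ , j≡) (inj₂ e) = inj₂ (trans e j≡)

perm-involutive : ∀ {n} (t : Transp n) x → perm t (perm t x) ≡ x
perm-involutive t = swap-involutive (i t) (j t)

i-moved : ∀ {n} (t : Transp n) → perm t (i t) ≢ i t
i-moved t e = <⇒≢ (i<j t) (sym (trans (sym (swap-at-a (i t) (j t))) e))

j-moved : ∀ {n} (t : Transp n) → perm t (j t) ≢ j t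
j-moved t e = <⇒≢ (i<j t) (trans (sym (swap-at-b (i t) (j t))) e)

-- A transposition (i j) with i < j is determined by its permutation:
-- both endpoints of each are moved by the other.
perm-injective : ∀ {n} (s t : Transp n) → perm s ≐ perm t → s ≈ₜ t
perm-injective s t eq =
  endpoints (swap-moved (i t) (j t) (i s) (λ e → i-moved s (trans (eq (i s)) e)))
            (swap-moved (i s) (j s) (i t) (λ e → i-moved t (trans (sym (eq (i t))) e)))
  where
  endpoints : i s ∈ₜ t → i t ∈ₜ s → s ≈ₜ t
  endpoints (inj₁ is≡it) _
    with swap-moved (i t) (j t) (j s) (λ e → j-moved s (trans (eq (j s)) e))
  ... | inj₁ js≡it = ⊥-elim (<⇒≢ (i<j s) (trans is≡it (sym js≡it)))
  ... | inj₂ js≡jt = is≡it , js≡jt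
  endpoints (inj₂ is≡jt) (inj₁ it≡is) = ⊥-elim (<⇒≢ (i<j t) (trans it≡is is≡jt))
  endpoints (inj₂ is≡jt) (inj₂ it≡js) =
    ⊥-elim (<-irrefl refl (<-trans (i<j s)
      (subst₂ F._<_ it≡js (sym is≡jt) (i<j t))))

-- Conjugating t by g with i(t) < i(g) fixes i(t) and sends j(t) to g(j(t)),
-- which is still larger than i(t); so g t g is again written (i(t) g(j(t))).
conjT-ordered : ∀ {n} (g t : Transp n) → i t F.< i g → i t F.< perm g (j t)
conjT-ordered g t it<ig with swap (i g) (j g) (j t) | swap-view (i g) (j g) (j t)
... | _ | at-a _ = <-trans it<ig (i<j g)
... | _ | at-b _ = it<ig
... | _ | elsewhere _ _ = i<j t

conjT : ∀ {n} (g t : Transp n) → i t F.< i g → Transp n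
conjT g t it<ig = tr (i t) (perm g (j t)) (conjT-ordered g t it<ig)

conjT-perm : ∀ {n} (g t : Transp n) (it<ig : i t F.< i g) →
             (perm g ∙ perm t ∙ perm g) ≐ perm (conjT g t it<ig)
conjT-perm g t it<ig x =
  trans (conj-swap (perm g) (perm g) (perm-involutive g) (perm-involutive g) (i t) (j t) x)
        (cong (λ y → swap y (perm g (j t)) x) g-fixes-it)
  where
  g-fixes-it : perm g (i t) ≡ i t
  g-fixes-it = swap-elsewhere (i g) (j g) (i t) (<⇒≢ it<ig) (<⇒≢ (<-trans it<ig (i<j g)))

conjT-support : ∀ {n} (g t : Transp n) (it<ig : i t F.< i g) (x : Fin n) →
                (x ∈ₜ t ⊎ x ∈ₜ g) ⇔ (x ∈ₜ conjT g t it<ig ⊎ x ∈ₜ g)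
conjT-support g t it<ig x = mk⇔ forth back
  where
  forth : x ∈ₜ t ⊎ x ∈ₜ g → (x ≡ i t ⊎ x ≡ swap (i g) (j g) (j t)) ⊎ x ∈ₜ g
  forth (inj₂ x∈g) = inj₂ x∈g
  forth (inj₁ (inj₁ x≡it)) = inj₁ (inj₁ x≡it)
  forth (inj₁ (inj₂ x≡jt)) with swap (i g) (j g) (j t) | swap-view (i g) (j g) (j t)
  ... | _ | at-a jt≡ig = inj₂ (inj₁ (trans x≡jt jt≡ig))
  ... | _ | at-b jt≡jg = inj₂ (inj₂ (trans x≡jt jt≡jg))
  ... | _ | elsewhere _ _ = inj₁ (inj₂ x≡jt)
  back : (x ≡ i t ⊎ x ≡ swap (i g) (j g) (j t)) ⊎ x ∈ₜ g → x ∈ₜ t ⊎ x ∈ₜ g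
  back (inj₂ x∈g) = inj₂ x∈g
  back (inj₁ (inj₁ x≡it)) = inj₁ (inj₁ x≡it)
  back (inj₁ (inj₂ x≡gjt)) with swap (i g) (j g) (j t) | swap-view (i g) (j g) (j t)
  ... | _ | at-a _ = inj₂ (inj₂ x≡gjt)
  ... | _ | at-b _ = inj₂ (inj₁ x≡gjt)
  ... | _ | elsewhere _ _ = inj₁ (inj₂ x≡gjt)

record BraidStep {n} (ta tb ua ub : Transp n) : Set where
  field
    caseEq : i ta ≡ i tb → (ua ≈ₜ ta) × (ub ≈ₜ tb)
    caseLt : i ta F.< i tb → (ua ≈ₜ tb) × (perm ub ≐ (perm tb ∙ perm ta ∙ perm tb))
    caseGt : i tb F.< i ta → (perm ua ≐ (perm ta ∙ perm tb ∙ perm ta)) × (ub ≈ₜ ta)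

braid : ∀ {n} → Transp n → Transp n → Transp n × Transp n
braid ta tb with <-cmp (i ta) (i tb)
... | tri< ia<ib _ _ = tb , conjT tb ta ia<ib
... | tri≈ _ _ _ = ta , tb
... | tri> _ _ ib<ia = conjT ta tb ib<ia , ta

braid-step : ∀ {n} (ta tb : Transp n) →
             BraidStep ta tb (proj₁ (braid ta tb)) (proj₂ (braid ta tb))
braid-step ta tb with <-cmp (i ta) (i tb)
... | tri< ia<ib ia≢ib ia≯ib = record
  { caseEq = λ e → ⊥-elim (ia≢ib e)
  ; caseLt = λ _ → (refl , refl) , λ x → sym (conjT-perm tb ta ia<ib x)
  ; caseGt = λ gt → ⊥-elim (ia≯ib gt) }
... | tri≈ ia≮ib _ ia≯ib = record
  { caseEq = λ _ → (refl , refl) , (refl , refl)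
  ; caseLt = λ lt → ⊥-elim (ia≮ib lt)
  ; caseGt = λ gt → ⊥-elim (ia≯ib gt) }
... | tri> ia≮ib ia≢ib ib<ia = record
  { caseEq = λ e → ⊥-elim (ia≢ib e)
  ; caseLt = λ lt → ⊥-elim (ia≮ib lt)
  ; caseGt = λ _ → (λ x → sym (conjT-perm ta tb ib<ia x)) , (refl , refl) }

-- Every result of the move agrees with the canonical one, because a
-- transposition is determined by its permutation.
braid-unique : ∀ {n} {ta tb ua ub : Transp n} → BraidStep ta tb ua ub →
               (ua ≈ₜ proj₁ (braid ta tb)) × (ub ≈ₜ proj₂ (braid ta tb))
braid-unique {ta = ta} {tb} {ua} {ub} step with <-cmp (i ta) (i tb)
... | tri< ia<ib _ _ =
  proj₁ (caseLt ia<ib) ,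
  perm-injective ub (conjT tb ta ia<ib)
    (λ x → trans (proj₂ (caseLt ia<ib) x) (conjT-perm tb ta ia<ib x))
  where open BraidStep step
... | tri≈ _ ia≡ib _ = caseEq ia≡ib
  where open BraidStep step
... | tri> _ _ ib<ia =
  perm-injective ua (conjT ta tb ib<ia)
    (λ x → trans (proj₁ (caseGt ib<ia) x) (conjT-perm ta tb ib<ia x)) ,
  proj₂ (caseGt ib<ia)
  where open BraidStep step

braid-firsts : ∀ {n} (ta tb : Transp n) →
               (i (proj₁ (braid ta tb)) ≡ i tb) × (i (proj₂ (braid ta tb)) ≡ i ta)
braid-firsts ta tb with <-cmp (i ta) (i tb)
... | tri< _ _ _ = refl , refl
... | tri≈ _ ia≡ib _ = ia≡ib , sym ia≡ib
... | tri> _ _ _ = refl , refl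

braid-support : ∀ {n} (ta tb : Transp n) (x : Fin n) →
                (x ∈ₜ ta ⊎ x ∈ₜ tb) ⇔ (x ∈ₜ proj₁ (braid ta tb) ⊎ x ∈ₜ proj₂ (braid ta tb))
braid-support ta tb x with <-cmp (i ta) (i tb)
... | tri< ia<ib _ _ =
  mk⇔ (λ m → ⊎-swap (to (conjT-support tb ta ia<ib x) m))
      (λ m → from (conjT-support tb ta ia<ib x) (⊎-swap m))
... | tri≈ _ _ _ = mk⇔ (λ m → m) (λ m → m)
... | tri> _ _ ib<ia =
  mk⇔ (λ m → to (conjT-support ta tb ib<ia x) (⊎-swap m))
      (λ m → ⊎-swap (from (conjT-support ta tb ib<ia x) m))

step-firsts : ∀ {n} {ta tb ua ub : Transp n} → BraidStep ta tb ua ub →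
              (i ua ≡ i tb) × (i ub ≡ i ta)
step-firsts {ta = ta} {tb} step =
  trans (proj₁ (proj₁ (braid-unique step))) (proj₁ (braid-firsts ta tb)) ,
  trans (proj₁ (proj₂ (braid-unique step))) (proj₂ (braid-firsts ta tb))

step-support : ∀ {n} {ta tb ua ub : Transp n} → BraidStep ta tb ua ub → ∀ x →
               (x ∈ₜ ta ⊎ x ∈ₜ tb) ⇔ (x ∈ₜ ua ⊎ x ∈ₜ ub)
step-support {ta = ta} {tb} {ua} {ub} step x =
  mk⇔ (λ m → toStep (to (braid-support ta tb x) m))
      (λ m → from (braid-support ta tb x) (toBraid m))
  where
  ua′ ub′ : Transp _
  ua′ = proj₁ (braid ta tb)
  ub′ = proj₂ (braid ta tb)
  ua≈ : ua ≈ₜ ua′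
  ua≈ = proj₁ (braid-unique step)
  ub≈ : ub ≈ₜ ub′
  ub≈ = proj₂ (braid-unique step)
  toStep : x ∈ₜ ua′ ⊎ x ∈ₜ ub′ → x ∈ₜ ua ⊎ x ∈ₜ ub
  toStep (inj₁ m) = inj₁ (∈ₜ-resp-≈ ua′ ua (≈ₜ-sym ua ua′ ua≈) m)
  toStep (inj₂ m) = inj₂ (∈ₜ-resp-≈ ub′ ub (≈ₜ-sym ub ub′ ub≈) m)
  toBraid : x ∈ₜ ua ⊎ x ∈ₜ ub → x ∈ₜ ua′ ⊎ x ∈ₜ ub′
  toBraid (inj₁ m) = inj₁ (∈ₜ-resp-≈ ua ua′ ua≈ m)
  toBraid (inj₂ m) = inj₂ (∈ₜ-resp-≈ ub ub′ ub≈ m)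

SameOutside : ∀ {n k} → Fin k → Fin k → Seq n k → Seq n k → Set
SameOutside a b γ δ = ∀ s → s ≢ a → s ≢ b → δ s ≈ₜ γ s

firsts-swapped : ∀ {n k} (γ δ : Seq n k) (a b : Fin k) → SameOutside a b γ δ →
                 i (δ a) ≡ i (γ b) → i (δ b) ≡ i (γ a) →
                 ∀ s → P δ s ≡ P γ (swap a b s)
firsts-swapped _ _ a b same at-a≡ at-b≡ s with swap a b s | swap-view a b s
... | _ | at-a refl = at-a≡
... | _ | at-b refl = at-b≡
... | _ | elsewhere s≢a s≢b = proj₁ (same s s≢a s≢b)

pair⇒support : ∀ {n k} (γ : Seq n k) (a b : Fin k) {x : Fin n} →
               x ∈ₜ γ a ⊎ x ∈ₜ γ b → Support γ x
pair⇒support _ a b (inj₁ x∈γa) = a , x∈γa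
pair⇒support _ a b (inj₂ x∈γb) = b , x∈γb

support-mono : ∀ {n k} (γ δ : Seq n k) (a b : Fin k) → SameOutside a b δ γ →
               (∀ {x} → x ∈ₜ γ a ⊎ x ∈ₜ γ b → x ∈ₜ δ a ⊎ x ∈ₜ δ b) →
               ∀ {x} → Support γ x → Support δ x
support-mono γ δ a b same pair (s , x∈γs) with s ≟ a | s ≟ b
... | yes refl | _ = pair⇒support δ a b (pair (inj₁ x∈γs))
... | no _ | yes refl = pair⇒support δ a b (pair (inj₂ x∈γs))
... | no s≢a | no s≢b = s , ∈ₜ-resp-≈ (γ s) (δ s) (same s s≢a s≢b) x∈γs

replacePair : ∀ {A : Set} {k} → (Fin k → A) → Fin k → Fin k → A → A → Fin k → A
replacePair xs a b u v = updateAt (updateAt xs a (const u)) b (const v)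

module _ {A : Set} {k} (xs : Fin k → A) (a b : Fin k) (u v : A) where

  replacePair-a : a ≢ b → replacePair xs a b u v a ≡ u
  replacePair-a a≢b =
    trans (updateAt-minimal a b (updateAt xs a (const u)) a≢b) (updateAt-updates a xs)

  replacePair-b : replacePair xs a b u v b ≡ v
  replacePair-b = updateAt-updates b (updateAt xs a (const u))

  replacePair-elsewhere : ∀ s → s ≢ a → s ≢ b → replacePair xs a b u v s ≡ xs s
  replacePair-elsewhere s s≢a s≢b =
    trans (updateAt-minimal s b (updateAt xs a (const u)) s≢b)
          (updateAt-minimal s a xs s≢a)

posA≢posB : ∀ {k} (l : ℕ) (h : suc l < k) → posA l h ≢ posB l h
posA≢posB l h e = ℕ.<⇒≢ (ℕ.n<1+n l)
  (trans (sym (toℕ-fromℕ< _)) (trans (cong toℕ e) (toℕ-fromℕ< h)))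

act-step : ∀ {n k} {l} {h : suc l < k} {γ δ : Seq n k} → ActΣ l h γ δ →
           BraidStep (γ (posA l h)) (γ (posB l h)) (δ (posA l h)) (δ (posB l h))
act-step act = record { caseEq = caseEq ; caseLt = caseLt ; caseGt = caseGt }
  where open ActΣ act

braidAt : ∀ {n k} (l : ℕ) (h : suc l < k) → Seq n k → Seq n k
braidAt l h γ = replacePair γ (posA l h) (posB l h)
  (proj₁ (braid (γ (posA l h)) (γ (posB l h))))
  (proj₂ (braid (γ (posA l h)) (γ (posB l h))))

braidAt-act : ∀ {n k} (l : ℕ) (h : suc l < k) (γ : Seq n k) → ActΣ l h γ (braidAt l h γ)
braidAt-act l h γ = record
  { others = λ s s≢a s≢b →
      let e = replacePair-elsewhere γ a b _ _ s s≢a s≢b in cong i e , cong j e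
  ; caseEq = BraidStep.caseEq step
  ; caseLt = BraidStep.caseLt step
  ; caseGt = BraidStep.caseGt step }
  where
  a = posA l h
  b = posB l h
  step : BraidStep (γ a) (γ b) (braidAt l h γ a) (braidAt l h γ b)
  step = subst₂ (BraidStep (γ a) (γ b))
           (sym (replacePair-a γ a b _ _ (posA≢posB l h)))
           (sym (replacePair-b γ a b _ _))
           (braid-step (γ a) (γ b))

act-properties : ∀ {n k} {l} {h : suc l < k} {γ δ : Seq n k} → ActΣ l h γ δ →
                 ((s : Fin k) → P δ s ≡ actSeq l h (P γ) s) ×
                 ((x : Fin n) → (Support γ x → Support δ x) × (Support δ x → Support γ x))
act-properties {l = l} {h} {γ} {δ} act =
  firsts-swapped γ δ a b others (proj₁ (step-firsts step)) (proj₂ (step-firsts step)) ,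
  λ x → support-mono γ δ a b (λ s s≢a s≢b → ≈ₜ-sym (δ s) (γ s) (others s s≢a s≢b))
                         (to (step-support step _)) ,
        support-mono δ γ a b others (from (step-support step _))
  where
  open ActΣ act using (others)
  a b : Fin _
  a = posA l h
  b = posB l h
  step : BraidStep (γ a) (γ b) (δ a) (δ b)
  step = act-step act

lemma4p1 : (n k : ℕ) (γ : Seq n k) → InΣ n k γ →
           (l : ℕ) (h : suc l < k) →
           (Σ (Seq n k) λ γ' → ActΣ l h γ γ') ×
           ((γ' : Seq n k) → ActΣ l h γ γ' →
             ((s : Fin k) → P γ' s ≡ actSeq l h (P γ) s) ×
             ((x : Fin n) → (Support γ x → Support γ' x) × (Support γ' x → Support γ x)))
lemma4p1 n k γ _ l h =
  (braidAt l h γ , braidAt-act l h γ) , λ γ' act → act-properties act
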